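{- Let $k\ge1$. For every formula $\varphi\in\mathsf{GC}^k$ and every guard function $f$ with $\mathrm{dom}(f)=\{i:\mathsf{v}_i\text{ is free in }\varphi\}$, there exists a formula $\varphi_f$ such that $(\mathrm{gd}(f)\wedge\varphi_f)\in\mathsf{RGC}^k$, $(\mathrm{gd}(f)\wedge\varphi)$ is equivalent to $(\mathrm{gd}(f)\wedge\varphi_f)$ (satisfied by exactly the same interpretations), and both formulas have the same set of free variables. In particular, if $\varphi$ is a sentence of $\mathsf{GC}^k$, then for the guard function $f$ with empty domain, $(\top\wedge\varphi_f)$ is a sentence of $\mathsf{RGC}^k$ equivalent to $\varphi$.
   Context: Incidence graphs: $I=(R(I),B(I),E(I))$ with disjoint finite sets of red and blue nodes, $E(I)\subseteq B(I)\times R(I)$, each red node adjacent to some blue node. Logic $\mathsf{GC}^k$: blue variables $\mathsf{e}_1,\dots,\mathsf{e}_k$ (ranging over blue nodes), red variables $\mathsf{v}_1,\mathsf{v}_2,\dots$ (over red nodes); an interpretation is an incidence graph with an assignment of all variables. A guard function is a partial function $g:\mathbb{N}_{\ge1}\rightharpoonup[k]$ with finite domain; $\mathrm{gd}(g):=\bigwedge_{i\in\mathrm{dom}(g)}E(\mathsf{e}_{g(i)},\mathsf{v}_i)$, or $\top$ if the domain is empty. Atomic formulas: $\top$, $E(\mathsf{e}_j,\mathsf{v}_i)$ (adjacency), $\mathsf{e}_j=\mathsf{e}_{j'}$, $\mathsf{v}_i=\mathsf{v}_{i'}$. $\mathsf{GC}^k$ is closed under $\neg,\wedge$, and: if $\psi\in\mathsf{GC}^k$,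 $g$ a guard function with $\mathrm{dom}(g)=\{i:\mathsf{v}_i$ free in $\psi\}$, $n,\ell\ge1$, $i_1<\dots<i_\ell$ with all $\mathsf{v}_{i_j}$ (resp. all $\mathsf{e}_{i_j}$) free in $(\mathrm{gd}(g)\wedge\psi)$, then $\exists^{\ge n}(\mathsf{v}_{i_1},\dots,\mathsf{v}_{i_\ell}).(\mathrm{gd}(g)\wedge\psi)$ (resp. the same with $\mathsf{e}_{i_j}$) is in $\mathsf{GC}^k$, with meaning "at least $n$ tuples of values of the quantified variables satisfy $(\mathrm{gd}(g)\wedge\psi)$". For partial functions: $f,g$ are compatible if they agree on $\mathrm{dom} f\cap\mathrm{dom} g$; $f\cup g$ has domain $\mathrm{dom} f\cup\mathrm{dom} g$, value $f(a)$ on $\mathrm{dom} f$ and $g(a)$ elsewhere; $g-S$ is the restriction of $g$ to $\mathrm{dom} g\setminus S$; $\mathrm{im}$ denotes image. $\mathsf{RGC}^k$ is the set of formulas of the form $(\mathrm{gd}(g)\wedge\psi)$ defined inductively: Base: (1) $\psi=E(\mathsf{e}_j,\mathsf{v}_i)$ with $\mathrm{dom}(g)=\{i\}$, $j\in[k]$ ($g(i)$ arbitrary); (2) $\psi$ is $\mathsf{e}_j=\mathsf{e}_{j'}$ with $\mathrm{dom}(g)=\emptyset$; (3) $\psi$ is $\mathsf{v}_i=\mathsf{v}_{i'}$ with $\mathrm{dom}(g)=\{i,i'\}$. Inductive: (4) if $(\mathrm{gd}(g)\wedge\psi)\in\mathsf{RGC}^k$ then $(\mathrm{gd}(g)\wedge\neg\psi)\in\mathsf{RGC}^k$;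 (5) if $(\mathrm{gd}(g_i)\wedge\psi_i)\in\mathsf{RGC}^k$ for $i\in[2]$ with $g_1,g_2$ compatible, then $(\mathrm{gd}(g_1\cup g_2)\wedge(\psi_1\wedge\psi_2))\in\mathsf{RGC}^k$; (6) if $(\mathrm{gd}(g)\wedge\psi)\in\mathsf{RGC}^k$, $n,\ell\ge1$, $i_1<\dots<i_\ell$ in $\mathrm{dom}(g)$, then $(\mathrm{gd}(\tilde g)\wedge\exists^{\ge n}(\mathsf{v}_{i_1},\dots,\mathsf{v}_{i_\ell}).(\mathrm{gd}(g)\wedge\psi))\in\mathsf{RGC}^k$ where $\tilde g=g-\{i_1,\dots,i_\ell\}$; (7) if $\chi=(\mathrm{gd}(g)\wedge\psi)\in\mathsf{RGC}^k$, $n,\ell\ge1$, $S=\{i_1<\dots<i_\ell\}$ a set of indices of blue variables free in $\chi$, and $\tilde g$ is a guard function with $\mathrm{dom}(\tilde g)=\mathrm{dom}(g)$ such that every $i\in\mathrm{dom}(g)$ satisfies $\tilde g(i)=g(i)$ or $\tilde g(i)\in S$ or $\tilde g(i)\notin\mathrm{im}(g)$, then $(\mathrm{gd}(\tilde g)\wedge\exists^{\ge n}(\mathsf{e}_{i_1},\dots,\mathsf{e}_{i_\ell}).(\mathrm{gd}(g)\wedge\psi))\in\mathsf{RGC}^k$. Note $\mathsf{RGC}^k\subseteq\mathsf{GC}^k$. -}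

module Defs where

open import Data.Nat using (ℕ; zero; suc; _≤_; _<_; _≤ᵇ_; _≡ᵇ_)
open import Data.Fin using (Fin)
import Data.Fin as F
open import Data.Bool using (Bool; true; false; _∧_; _∨_; not; if_then_else_)
open import Data.Maybe using (Maybe; just; nothing; is-just)
open import Data.List using (List; []; _∷_; map; upTo; allFin; concatMap; length)
open import Data.Bool.ListAction using (any)
open import Data.Nat.ListAction using (sum)
open import Data.List.Relation.Unary.All using (All)
open import Data.List.Relation.Unary.Linked using (Linked)
open import Data.List.Membership.Propositional using (_∈_)
open import Data.Product using (Σ; ∃; _×_; _,_)
open import Data.Sum using (_⊎_)
open import Relation.Nullary using (¬_; ⌊_⌋)
open import Relation.Binary.PropositionalEquality using (_≡_)

-- Conventions
--   * blue variables e₁,…,e_k are indexed by  Fin k   (index j ↔ e_{j+1})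
--   * red variables  v₁,v₂,…  are indexed by  ℕ       (index i ↔ v_{i+1})

record IncGraph : Set where
  field
    nR nB : ℕ
    E     : Fin nB → Fin nR → Bool
    cover : ∀ (v : Fin nR) → ∃ λ (e : Fin nB) → E e v ≡ true

open IncGraph public

data Formula (k : ℕ) : Set where
  ⊤'   : Formula k
  E'   : Fin k → ℕ → Formula k
  eqB  : Fin k → Fin k → Formula k
  eqR  : ℕ → ℕ → Formula k
  ¬'_  : Formula k → Formula k
  _∧'_ : Formula k → Formula k → Formula k
  ∃R   : ℕ → List ℕ → Formula k → Formula k
  ∃B   : ℕ → List (Fin k) → Formula k → Formula k

infixr 6 _∧'_

_=ᶠ_ : ∀ {k} → Fin k → Fin k → Bool
a =ᶠ b = ⌊ a F.≟ b ⌋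

elemℕ : ℕ → List ℕ → Bool
elemℕ x = any (λ y → x ≡ᵇ y)

elemF : ∀ {k} → Fin k → List (Fin k) → Bool
elemF x = any (λ y → x =ᶠ y)

freeR : ∀ {k} → Formula k → ℕ → Bool
freeR ⊤'          x = false
freeR (E' j i)    x = i ≡ᵇ x
freeR (eqB j j')  x = false
freeR (eqR i i')  x = (i ≡ᵇ x) ∨ (i' ≡ᵇ x)
freeR (¬' φ)      x = freeR φ x
freeR (φ ∧' ψ)    x = freeR φ x ∨ freeR ψ x
freeR (∃R n xs φ) x = not (elemℕ x xs) ∧ freeR φ x
freeR (∃B n xs φ) x = freeR φ x

freeB : ∀ {k} → Formula k → Fin k → Bool
freeB ⊤'          y = false
freeB (E' j i)    y = j =ᶠ y
freeB (eqB j j')  y = (j =ᶠ y) ∨ (j' =ᶠ y)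
freeB (eqR i i')  y = false
freeB (¬' φ)      y = freeB φ y
freeB (φ ∧' ψ)    y = freeB φ y ∨ freeB ψ y
freeB (∃R n xs φ) y = freeB φ y
freeB (∃B n xs φ) y = not (elemF y xs) ∧ freeB φ y

record Guard (k : ℕ) : Set where
  field
    fun    : ℕ → Maybe (Fin k)
    bound  : ℕ
    finite : ∀ i → bound ≤ i → fun i ≡ nothing

open Guard public

dom : ∀ {k} → Guard k → ℕ → Bool
dom g i = is-just (fun g i)

InIm : ∀ {k} → Guard k → Fin k → Set
InIm g j = ∃ λ i → fun g i ≡ just j

conj : ∀ {k} → List (Formula k) → Formula k
conj []           = ⊤'
conj (φ ∷ [])     = φ
conj (φ ∷ ψ ∷ φs) = φ ∧' conj (ψ ∷ φs)

guardAtom : ∀ {k} → (ℕ → Maybe (Fin k)) → ℕ → List (Formula k)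
guardAtom f i with f i
... | just j  = E' j i ∷ []
... | nothing = []

gd : ∀ {k} → Guard k → Formula k
gd g = conj (concatMap (guardAtom (fun g)) (upTo (bound g)))

Compatible : ∀ {k} → Guard k → Guard k → Set
Compatible g h = ∀ i a b → fun g i ≡ just a → fun h i ≡ just b → a ≡ b

unionFun : ∀ {k} → Guard k → Guard k → ℕ → Maybe (Fin k)
unionFun g h i with fun g i
... | just a  = just a
... | nothing = fun h i

minusFun : ∀ {k} → Guard k → List ℕ → ℕ → Maybe (Fin k)
minusFun g S i = if elemℕ i S then nothing else fun g i

module _ {k : ℕ} (I : IncGraph) where

  RAssign = ℕ → Fin (nR I)
  BAssign = Fin k → Fin (nB I)

  updR : RAssign → ℕ → Fin (nR I) → RAssign
  updR ρ x a i = if i ≡ᵇ x then a else ρ i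

  updB : BAssign → Fin k → Fin (nB I) → BAssign
  updB σ y a j = if j =ᶠ y then a else σ j

  countR : RAssign → List ℕ → (RAssign → Bool) → ℕ
  countR ρ []       P = if P ρ then 1 else 0
  countR ρ (x ∷ xs) P = sum (map (λ a → countR (updR ρ x a) xs P) (allFin (nR I)))

  countB : BAssign → List (Fin k) → (BAssign → Bool) → ℕ
  countB σ []       P = if P σ then 1 else 0
  countB σ (y ∷ ys) P = sum (map (λ a → countB (updB σ y a) ys P) (allFin (nB I)))

  eval : Formula k → RAssign → BAssign → Bool
  eval ⊤'          ρ σ = true
  eval (E' j i)    ρ σ = E I (σ j) (ρ i)
  eval (eqB j j')  ρ σ = σ j =ᶠ σ j'
  eval (eqR i i')  ρ σ = ρ i =ᶠ ρ i'
  eval (¬' φ)      ρ σ = not (eval φ ρ σ)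
  eval (φ ∧' ψ)    ρ σ = eval φ ρ σ ∧ eval ψ ρ σ
  eval (∃R n xs φ) ρ σ = n ≤ᵇ countR ρ xs (λ ρ' → eval φ ρ' σ)
  eval (∃B n ys φ) ρ σ = n ≤ᵇ countB σ ys (λ σ' → eval φ ρ σ')

Equivalent : ∀ {k} → Formula k → Formula k → Set
Equivalent {k} φ ψ = ∀ (I : IncGraph) (ρ : ℕ → Fin (nR I)) (σ : Fin k → Fin (nB I)) →
  eval I φ ρ σ ≡ eval I ψ ρ σ

SameFree : ∀ {k} → Formula k → Formula k → Set
SameFree φ ψ = (∀ i → freeR φ i ≡ freeR ψ i) × (∀ j → freeB φ j ≡ freeB ψ j)

_<F_ : ∀ {k} → Fin k → Fin k → Set
a <F b = a F.< b

data GC {k : ℕ} : Formula k → Set where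
  gc-⊤   : GC ⊤'
  gc-E   : ∀ j i → GC (E' j i)
  gc-eqB : ∀ j j' → GC (eqB j j')
  gc-eqR : ∀ i i' → GC (eqR i i')
  gc-¬   : ∀ {φ} → GC φ → GC (¬' φ)
  gc-∧   : ∀ {φ ψ} → GC φ → GC ψ → GC (φ ∧' ψ)
  gc-∃R  : ∀ {ψ} (g : Guard k) (n : ℕ) (xs : List ℕ) →
           GC ψ →
           (∀ i → dom g i ≡ freeR ψ i) →
           1 ≤ n → 1 ≤ length xs → Linked _<_ xs →
           All (λ x → freeR (gd g ∧' ψ) x ≡ true) xs →
           GC (∃R n xs (gd g ∧' ψ))
  gc-∃B  : ∀ {ψ} (g : Guard k) (n : ℕ) (ys : List (Fin k)) →
           GC ψ →
           (∀ i → dom g i ≡ freeR ψ i) →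
           1 ≤ n → 1 ≤ length ys → Linked _<F_ ys →
           All (λ y → freeB (gd g ∧' ψ) y ≡ true) ys →
           GC (∃B n ys (gd g ∧' ψ))

-- The fragment RGC^k :  RGC g ψ  means  (gd(g) ∧ ψ) ∈ RGC^k

data RGC {k : ℕ} : Guard k → Formula k → Set where
  rgc-E   : ∀ (g : Guard k) j i → (∀ x → dom g x ≡ (x ≡ᵇ i)) → RGC g (E' j i)
  rgc-eqB : ∀ (g : Guard k) j j' → (∀ x → dom g x ≡ false) → RGC g (eqB j j')
  rgc-eqR : ∀ (g : Guard k) i i' → (∀ x → dom g x ≡ ((x ≡ᵇ i) ∨ (x ≡ᵇ i'))) →
            RGC g (eqR i i')
  rgc-¬   : ∀ {g ψ} → RGC g ψ → RGC g (¬' ψ)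
  rgc-∧   : ∀ {g₁ g₂ ψ₁ ψ₂} (h : Guard k) →
            RGC g₁ ψ₁ → RGC g₂ ψ₂ → Compatible g₁ g₂ →
            (∀ i → fun h i ≡ unionFun g₁ g₂ i) →
            RGC h (ψ₁ ∧' ψ₂)
  rgc-∃R  : ∀ {g ψ} (h : Guard k) (n : ℕ) (xs : List ℕ) →
            RGC g ψ →
            1 ≤ n → 1 ≤ length xs → Linked _<_ xs →
            All (λ x → dom g x ≡ true) xs →
            (∀ i → fun h i ≡ minusFun g xs i) →
            RGC h (∃R n xs (gd g ∧' ψ))
  rgc-∃B  : ∀ {g ψ} (h : Guard k) (n : ℕ) (ys : List (Fin k)) →
            RGC g ψ →
            1 ≤ n → 1 ≤ length ys → Linked _<F_ ys →
            All (λ y → freeB (gd g ∧' ψ) y ≡ true) ys →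
            (∀ i → dom h i ≡ dom g i) →
            (∀ i j → fun h i ≡ just j →
               fun g i ≡ just j ⊎ j ∈ ys ⊎ ¬ InIm g j) →
            RGC h (∃B n ys (gd g ∧' ψ))

-- Atoms are already in RGC^k, negation is immediate, and a
-- conjunction is split by restricting f to the free variables of each conjunct. The tautology ⊤
-- is replaced by ∃^{≥1} e. (e = e), which needs k ≥ 1. For a quantification of (gd g ∧ ψ) the
-- inner guard g is replaced by g', which agrees with g on the bound variables and with f on the
-- others (as rule (6) resp. (7) demands), and the body is translated under g' as the conjunction
-- gd g ∧ ψ: keeping gd g inside the body restores the constraints on the free variables that g'
-- no longer expresses, and under the outer guard gd f the formula gd g implies gd g'.
module Submission where

open import Defs
open import Data.Nat using (ℕ; suc; _+_; _≤_; _<_; _≤ᵇ_; _≡ᵇ_; _≟_; _≤?_)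
open import Data.Nat.Properties
  using (≡ᵇ⇒≡; ≡⇒≡ᵇ; ≤⇒≤ᵇ; ≰⇒>; m≤m+n; m≤n+m; ≤-refl; ≤-trans; ≤-reflexive)
open import Data.Nat.ListAction using (sum)
open import Data.Fin using (Fin)
import Data.Fin as F
open import Data.Bool using (Bool; true; false; _∧_; _∨_; not; if_then_else_)
open import Data.Bool.Properties
  using (∧-conicalˡ; ∧-conicalʳ; ∨-conicalˡ; ∨-conicalʳ; ∨-zeroʳ; ∨-idem; T-≡; ⇔→≡)
open import Data.Maybe using (Maybe; just; nothing; is-just; maybe′)
open import Data.Maybe.Properties using (just-injective)
open import Data.List using (List; []; _∷_; map; upTo; allFin; concatMap; length)
open import Data.List.Properties using (map-cong)
open import Data.List.Relation.Unary.All as All using (All; []; _∷_)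
open import Data.List.Relation.Unary.Any using (Any; here; there; satisfied)
open import Data.List.Relation.Unary.Linked using (Linked; [-])
open import Data.List.Membership.Propositional using (_∈_; find; lose)
open import Data.List.Membership.Propositional.Properties
  using (∈-concatMap⁺; ∈-concatMap⁻; ∈-upTo⁺; ∈-map⁺; ∈-allFin)
open import Data.Product using (Σ; ∃; ∃₂; _×_; _,_)
open import Data.Sum using (_⊎_; inj₁; inj₂; [_,_]′)
open import Function using (_∘_; Equivalence; mk⇔)
open import Relation.Nullary using (Dec; yes; no; ¬_; ⌊_⌋; contradiction)
open import Relation.Nullary.Decidable using (does-⇔)
open import Relation.Binary.PropositionalEquality
  using (_≡_; refl; sym; trans; cong; cong₂; subst; module ≡-Reasoning)

isYes⇒ : ∀ {a} {A : Set a} (a? : Dec A) → ⌊ a? ⌋ ≡ true → A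
isYes⇒ (yes a) _ = a

-- `does (m ≟ n)` computes to `m ≡ᵇ n`.
≡ᵇ-sym : ∀ m n → (m ≡ᵇ n) ≡ (n ≡ᵇ m)
≡ᵇ-sym m n = does-⇔ (mk⇔ sym sym) (m ≟ n) (n ≟ m)

=ᶠ-refl : ∀ {k} (a : Fin k) → (a =ᶠ a) ≡ true
=ᶠ-refl a with a F.≟ a
... | yes _   = refl
... | no  a≢a = contradiction refl a≢a

∧-guarded-cong : ∀ {a p q} → (a ≡ true → p ≡ q) → a ∧ p ≡ a ∧ q
∧-guarded-cong {true}  p≡q = p≡q refl
∧-guarded-cong {false} _   = refl

∨-guarded-cong : ∀ {a p q} → (a ≡ false → p ≡ q) → a ∨ p ≡ a ∨ q
∨-guarded-cong {true}  _   = refl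
∨-guarded-cong {false} p≡q = p≡q refl

∨-true⁻ : ∀ a {b} → a ∨ b ≡ true → a ≡ true ⊎ b ≡ true
∨-true⁻ true  e = inj₁ e
∨-true⁻ false e = inj₂ e

∧-transfer : ∀ a c p q → (a ≡ true → c ≡ true) → (c ≡ true → a ∧ p ≡ q) → a ∧ p ≡ c ∧ q
∧-transfer true  c     p q a⇒c c⇒ with refl ← a⇒c refl = c⇒ refl
∧-transfer false true  p q _   c⇒ = c⇒ refl
∧-transfer false false p q _   _  = refl

∈⇒≤sum : ∀ {n ns} → n ∈ ns → n ≤ sum ns
∈⇒≤sum (here refl) = m≤m+n _ _
∈⇒≤sum {ns = m ∷ _} (there n∈ns) = ≤-trans (∈⇒≤sum n∈ns) (m≤n+m _ m)

elemF⇒∈ : ∀ {k} {x : Fin k} ys → elemF x ys ≡ true → x ∈ ys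
elemF⇒∈ {x = x} (y ∷ ys) e with x F.≟ y
... | yes refl = here refl
... | no _     = there (elemF⇒∈ ys e)

module _ {k : ℕ} where

  conj-true⁻ : ∀ I ρ σ (φs : List (Formula k)) →
               eval I (conj φs) ρ σ ≡ true → All (λ φ → eval I φ ρ σ ≡ true) φs
  conj-true⁻ I ρ σ []           _ = []
  conj-true⁻ I ρ σ (φ ∷ [])     e = e ∷ []
  conj-true⁻ I ρ σ (φ ∷ ψ ∷ φs) e =
    ∧-conicalˡ _ _ e ∷ conj-true⁻ I ρ σ (ψ ∷ φs) (∧-conicalʳ _ _ e)

  conj-true⁺ : ∀ I ρ σ (φs : List (Formula k)) →
               All (λ φ → eval I φ ρ σ ≡ true) φs → eval I (conj φs) ρ σ ≡ true
  conj-true⁺ I ρ σ []           []             = refl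
  conj-true⁺ I ρ σ (φ ∷ [])     (e ∷ [])       = e
  conj-true⁺ I ρ σ (φ ∷ ψ ∷ φs) (e ∷ es) rewrite e = conj-true⁺ I ρ σ (ψ ∷ φs) es

  module _ (F : Formula k → Bool) (F-⊤ : F ⊤' ≡ false)
           (F-∧ : ∀ φ ψ → F (φ ∧' ψ) ≡ F φ ∨ F ψ) where

    conj-any⁻ : ∀ φs → F (conj φs) ≡ true → Any (λ φ → F φ ≡ true) φs
    conj-any⁻ []           e with () ← trans (sym e) F-⊤
    conj-any⁻ (φ ∷ [])     e = here e
    conj-any⁻ (φ ∷ ψ ∷ φs) e =
      [ here , there ∘ conj-any⁻ (ψ ∷ φs) ]′ (∨-true⁻ (F φ) (trans (sym (F-∧ φ _)) e))

    conj-any⁺ : ∀ φs → Any (λ φ → F φ ≡ true) φs → F (conj φs) ≡ true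
    conj-any⁺ (φ ∷ [])     (here e)  = e
    conj-any⁺ (φ ∷ ψ ∷ φs) (here e)  = trans (F-∧ φ _) (cong (_∨ F (conj (ψ ∷ φs))) e)
    conj-any⁺ (φ ∷ ψ ∷ φs) (there a) =
      trans (F-∧ φ _) (trans (cong (F φ ∨_) (conj-any⁺ (ψ ∷ φs) a)) (∨-zeroʳ (F φ)))

  atoms : Guard k → List (Formula k)
  atoms g = concatMap (guardAtom (fun g)) (upTo (bound g))

  ∈-guardAtom⁺ : ∀ h {i j} → h i ≡ just j → E' j i ∈ guardAtom {k} h i
  ∈-guardAtom⁺ h {i} hi with h i | hi
  ... | just j | refl = here refl

  ∈-guardAtom⁻ : ∀ h i {φ} → φ ∈ guardAtom {k} h i → ∃ λ j → h i ≡ just j × φ ≡ E' j i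
  ∈-guardAtom⁻ h i m with h i
  ∈-guardAtom⁻ h i (here refl) | just j = j , refl , refl

  just⇒<bound : ∀ (g : Guard k) {i j} → fun g i ≡ just j → i < bound g
  just⇒<bound g {i} gi with bound g ≤? i
  ... | yes b≤i with () ← trans (sym gi) (finite g i b≤i)
  ... | no  b≰i = ≰⇒> b≰i

  ∈-atoms⁺ : ∀ (g : Guard k) {i j} → fun g i ≡ just j → E' j i ∈ atoms g
  ∈-atoms⁺ g gi =
    ∈-concatMap⁺ (guardAtom (fun g)) (lose (∈-upTo⁺ (just⇒<bound g gi)) (∈-guardAtom⁺ (fun g) gi))

  ∈-atoms⁻ : ∀ (g : Guard k) {φ} → φ ∈ atoms g → ∃₂ λ i j → fun g i ≡ just j × φ ≡ E' j i
  ∈-atoms⁻ g m with satisfied (∈-concatMap⁻ (guardAtom (fun g)) {xs = upTo (bound g)} m)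
  ... | i , m′ = i , ∈-guardAtom⁻ (fun g) i m′

  Holds : (I : IncGraph) → (ℕ → Fin (nR I)) → (Fin k → Fin (nB I)) → Guard k → Set
  Holds I ρ σ g = ∀ {i j} → fun g i ≡ just j → E I (σ j) (ρ i) ≡ true

  eval-gd⁻ : ∀ {I ρ σ} (g : Guard k) → eval I (gd g) ρ σ ≡ true → Holds I ρ σ g
  eval-gd⁻ {I} {ρ} {σ} g e gi = All.lookup (conj-true⁻ I ρ σ (atoms g) e) (∈-atoms⁺ g gi)

  eval-gd⁺ : ∀ {I ρ σ} (g : Guard k) → Holds I ρ σ g → eval I (gd g) ρ σ ≡ true
  eval-gd⁺ {I} {ρ} {σ} g h = conj-true⁺ I ρ σ (atoms g) (All.tabulate atom-holds)
    where
      atom-holds : ∀ {φ} → φ ∈ atoms g → eval I φ ρ σ ≡ true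
      atom-holds m with ∈-atoms⁻ g m
      ... | i , j , gi , refl = h gi

  freeR-gd : ∀ (g : Guard k) x → freeR (gd g) x ≡ dom g x
  freeR-gd g x = ⇔→≡ (mk⇔ to from)
    where
      to : freeR (gd g) x ≡ true → dom g x ≡ true
      to e with find (conj-any⁻ (λ φ → freeR φ x) refl (λ _ _ → refl) (atoms g) e)
      ... | φ , m , x-free with ∈-atoms⁻ g m
      ...   | i , j , gi , refl with refl ← ≡ᵇ⇒≡ i x (Equivalence.from T-≡ x-free) = cong is-just gi
      from : dom g x ≡ true → freeR (gd g) x ≡ true
      from e with fun g x in gx
      ... | just j = conj-any⁺ (λ φ → freeR φ x) refl (λ _ _ → refl) (atoms g)
                       (lose (∈-atoms⁺ g gx) (Equivalence.to T-≡ (≡⇒≡ᵇ x x refl)))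

  freeB-gd⁺ : ∀ (g : Guard k) {i y} → fun g i ≡ just y → freeB (gd g) y ≡ true
  freeB-gd⁺ g {y = y} gi =
    conj-any⁺ (λ φ → freeB φ y) refl (λ _ _ → refl) (atoms g) (lose (∈-atoms⁺ g gi) (=ᶠ-refl y))

  freeB-gd⁻ : ∀ (g : Guard k) y → freeB (gd g) y ≡ true → InIm g y
  freeB-gd⁻ g y e with find (conj-any⁻ (λ φ → freeB φ y) refl (λ _ _ → refl) (atoms g) e)
  ... | φ , m , y-free with ∈-atoms⁻ g m
  ...   | i , j , gi , refl with refl ← isYes⇒ (j F.≟ y) y-free = i , gi

  freeB-gd-⊆ : ∀ (f g : Guard k) → (∀ {i j} → fun g i ≡ just j → InIm f j) →
               ∀ y → freeB (gd f) y ≡ false → freeB (gd g) y ≡ false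
  freeB-gd-⊆ f g g⊆f y f∌y with freeB (gd g) y in g∋y
  ... | false = refl
  ... | true with freeB-gd⁻ g y g∋y
  ...   | _ , gi with g⊆f gi
  ...     | _ , fi with () ← trans (sym (freeB-gd⁺ f fi)) f∌y

  ∅ : Guard k
  ∅ = record { fun = λ _ → nothing ; bound = 0 ; finite = λ _ _ → refl }

  dom-false⇒nothing : ∀ (g : Guard k) {i} → dom g i ≡ false → fun g i ≡ nothing
  dom-false⇒nothing g {i} e with fun g i
  ... | nothing = refl

  splice : (ℕ → Bool) → Guard k → Guard k → Guard k
  splice P g h = record
    { fun    = λ i → if P i then fun g i else fun h i
    ; bound  = bound g + bound h
    ; finite = finite′
    }
    where
      finite′ : ∀ i → bound g + bound h ≤ i → (if P i then fun g i else fun h i) ≡ nothing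
      finite′ i b with P i
      ... | true  = finite g i (≤-trans (m≤m+n _ _) b)
      ... | false = finite h i (≤-trans (m≤n+m _ _) b)

  splice-cover : ∀ P (g h : Guard k) {i j} → fun (splice P g h) i ≡ just j → InIm g j ⊎ InIm h j
  splice-cover P g h {i} e with P i
  ... | true  = inj₁ (i , e)
  ... | false = inj₂ (i , e)

  dom-splice : ∀ P (g h : Guard k) → (∀ i → P i ≡ false → dom h i ≡ dom g i) →
               ∀ i → dom (splice P g h) i ≡ dom g i
  dom-splice P g h h≈g i with P i in e
  ... | true  = refl
  ... | false = h≈g i e

  splice-holds : ∀ {I ρ σ} P (g h : Guard k) → Holds I ρ σ g →
                 (∀ {i j} → P i ≡ false → fun h i ≡ just j → E I (σ j) (ρ i) ≡ true) →
                 Holds I ρ σ (splice P g h)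
  splice-holds P g h g-holds h-holds {i} e with P i in p
  ... | true  = g-holds e
  ... | false = h-holds p e

  restrict : Guard k → (ℕ → Bool) → Guard k
  restrict g P = splice P g ∅

  restrict-⊆ : ∀ (g : Guard k) P {i j} → fun (restrict g P) i ≡ just j → fun g i ≡ just j
  restrict-⊆ g P {i} e with P i
  ... | true = e

  dom-restrict : ∀ (g : Guard k) {P} → (∀ i → P i ≡ true → dom g i ≡ true) →
                 ∀ i → dom (restrict g P) i ≡ P i
  dom-restrict g {P} P⊆g i with P i in e
  ... | true  = P⊆g i e
  ... | false = refl

  restrict-compatible : ∀ (g : Guard k) P Q → Compatible (restrict g P) (restrict g Q)
  restrict-compatible g P Q i a b gPi gQi =
    just-injective (trans (sym (restrict-⊆ g P gPi)) (restrict-⊆ g Q gQi))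

  unionFun-maybe : ∀ (g h : Guard k) i → unionFun g h i ≡ maybe′ just (fun h i) (fun g i)
  unionFun-maybe g h i with fun g i
  ... | just _  = refl
  ... | nothing = refl

  restrict-union : ∀ (g : Guard k) P Q → (∀ i → dom g i ≡ P i ∨ Q i) →
                   ∀ i → fun g i ≡ unionFun (restrict g P) (restrict g Q) i
  restrict-union g P Q d i = trans (pointwise (P i) (Q i) (fun g i) (d i))
                                   (sym (unionFun-maybe (restrict g P) (restrict g Q) i))
    where
      pointwise : ∀ p q m → is-just m ≡ p ∨ q →
                  m ≡ maybe′ just (if q then m else nothing) (if p then m else nothing)
      pointwise true  q     (just _) _ = refl
      pointwise true  true  nothing  _ = refl
      pointwise true  false nothing  _ = refl
      pointwise false true  m        _ = refl
      pointwise false false nothing  _ = refl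

  countR-cong : ∀ (I : IncGraph) ρ xs {P Q : (ℕ → Fin (nR I)) → Bool} →
                (∀ ρ′ → (∀ i → elemℕ i xs ≡ false → ρ′ i ≡ ρ i) → P ρ′ ≡ Q ρ′) →
                countR {k} I ρ xs P ≡ countR {k} I ρ xs Q
  countR-cong I ρ []       P≡Q = cong (λ b → if b then 1 else 0) (P≡Q ρ λ _ _ → refl)
  countR-cong I ρ (x ∷ xs) {P} {Q} P≡Q = cong sum (map-cong step (allFin _))
    where
      step : ∀ a → countR {k} I (updR {k} I ρ x a) xs P ≡ countR {k} I (updR {k} I ρ x a) xs Q
      step a = countR-cong I (updR {k} I ρ x a) xs λ ρ′ agree → P≡Q ρ′ λ i e →
        trans (agree i (∨-conicalʳ _ _ e)) (cong (λ b → if b then a else ρ i) (∨-conicalˡ _ _ e))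

  countB-cong : ∀ (I : IncGraph) σ ys {P Q : (Fin k → Fin (nB I)) → Bool} →
                (∀ σ′ → (∀ j → elemF j ys ≡ false → σ′ j ≡ σ j) → P σ′ ≡ Q σ′) →
                countB I σ ys P ≡ countB I σ ys Q
  countB-cong I σ []       P≡Q = cong (λ b → if b then 1 else 0) (P≡Q σ λ _ _ → refl)
  countB-cong I σ (y ∷ ys) {P} {Q} P≡Q = cong sum (map-cong step (allFin _))
    where
      step : ∀ a → countB I (updB I σ y a) ys P ≡ countB I (updB I σ y a) ys Q
      step a = countB-cong I (updB I σ y a) ys λ σ′ agree → P≡Q σ′ λ j e →
        trans (agree j (∨-conicalʳ _ _ e)) (cong (λ b → if b then a else σ j) (∨-conicalˡ _ _ e))

-- Free blue variables need only agree outside those of gd f, and truth only where gd f holds,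
-- since the theorem compares gd f ∧ φ with gd f ∧ φf.
record Translation {k} (f : Guard k) (φ : Formula k) : Set where
  field
    formula    : Formula k
    restricted : RGC f formula
    agrees     : ∀ I ρ σ → eval I (gd f) ρ σ ≡ true → eval I φ ρ σ ≡ eval I formula ρ σ
    same-freeR : ∀ x → freeR φ x ≡ freeR formula x
    same-freeB : ∀ y → freeB (gd f) y ≡ false → freeB φ y ≡ freeB formula y

open Translation

Translatable : ∀ {k} → Formula k → Set
Translatable {k} φ = (f : Guard k) → (∀ i → dom f i ≡ freeR φ i) → Translation f φ

module _ {k : ℕ} where

  translation-self : ∀ {f : Guard k} {φ} → RGC f φ → Translation f φ
  translation-self {φ = φ} r = record
    { formula    = φ
    ; restricted = r
    ; agrees     = λ _ _ _ _ → refl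
    ; same-freeR = λ _ → refl
    ; same-freeB = λ _ _ → refl
    }

  translate-E : ∀ j i → Translatable {k} (E' j i)
  translate-E j i f df = translation-self (rgc-E f j i λ x → trans (df x) (≡ᵇ-sym i x))

  translate-eqB : ∀ j j′ → Translatable {k} (eqB j j′)
  translate-eqB j j′ f df = translation-self (rgc-eqB f j j′ df)

  translate-eqR : ∀ i i′ → Translatable {k} (eqR i i′)
  translate-eqR i i′ f df =
    translation-self (rgc-eqR f i i′ λ x → trans (df x) (cong₂ _∨_ (≡ᵇ-sym i x) (≡ᵇ-sym i′ x)))

  translate-¬ : ∀ {φ : Formula k} → Translatable φ → Translatable (¬' φ)
  translate-¬ {φ} t f df = record
    { formula    = ¬' formula T
    ; restricted = rgc-¬ (restricted T)
    ; agrees     = λ I ρ σ f-holds → cong not (agrees T I ρ σ f-holds)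
    ; same-freeR = same-freeR T
    ; same-freeB = same-freeB T
    }
    where
      T : Translation f φ
      T = t f df

  translate-∧ : ∀ {φ ψ : Formula k} → Translatable φ → Translatable ψ → Translatable (φ ∧' ψ)
  translate-∧ {φ} {ψ} tφ tψ f df = record
    { formula    = formula Tφ ∧' formula Tψ
    ; restricted = rgc-∧ f (restricted Tφ) (restricted Tψ)
                     (restrict-compatible f (freeR φ) (freeR ψ))
                     (restrict-union f (freeR φ) (freeR ψ) df)
    ; agrees     = λ I ρ σ f-holds →
        cong₂ _∧_ (agrees Tφ I ρ σ (restricted-holds f-holds))
                  (agrees Tψ I ρ σ (restricted-holds f-holds))
    ; same-freeR = λ x → cong₂ _∨_ (same-freeR Tφ x) (same-freeR Tψ x)
    ; same-freeB = λ y f∌y →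
        cong₂ _∨_ (same-freeB Tφ y (restricted-∌ y f∌y)) (same-freeB Tψ y (restricted-∌ y f∌y))
    }
    where
      Tφ : Translation (restrict f (freeR φ)) φ
      Tφ = tφ (restrict f (freeR φ)) (dom-restrict f λ i e → trans (df i) (cong (_∨ freeR ψ i) e))
      Tψ : Translation (restrict f (freeR ψ)) ψ
      Tψ = tψ (restrict f (freeR ψ)) (dom-restrict f λ i e →
             trans (df i) (trans (cong (freeR φ i ∨_) e) (∨-zeroʳ _)))
      restricted-holds : ∀ {I ρ σ P} →
                         eval I (gd f) ρ σ ≡ true → eval I (gd (restrict f P)) ρ σ ≡ true
      restricted-holds {P = P} f-holds =
        eval-gd⁺ (restrict f P) λ fi → eval-gd⁻ f f-holds (restrict-⊆ f P fi)
      restricted-∌ : ∀ {P} y → freeB (gd f) y ≡ false → freeB (gd (restrict f P)) y ≡ false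
      restricted-∌ {P} = freeB-gd-⊆ f (restrict f P) λ fi → _ , restrict-⊆ f P fi

  translate-⊤ : Fin k → Translatable ⊤'
  translate-⊤ b f df = record
    { formula    = ∃B 1 (b ∷ []) (gd ∅ ∧' eqB b b)
    ; restricted = rgc-∃B f 1 (b ∷ []) (rgc-eqB ∅ b b λ _ → refl) ≤-refl ≤-refl [-]
                     (b-free ∷ []) df
                     λ i j fi → contradiction (trans (sym (df i)) (cong is-just fi)) λ ()
    ; agrees     = λ I ρ σ _ → sym (Equivalence.to T-≡ (≤⇒≤ᵇ (count-positive I ρ σ)))
    ; same-freeR = λ _ → refl
    ; same-freeB = λ y _ → b-bound y
    }
    where
      b-free : freeB (gd ∅ ∧' eqB b b) b ≡ true
      b-free rewrite =ᶠ-refl b = refl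
      b-bound : ∀ y → false ≡ freeB (∃B 1 (b ∷ []) (gd ∅ ∧' eqB b b)) y
      b-bound y with y F.≟ b
      ... | yes refl = refl
      ... | no  y≢b with b F.≟ y
      ...   | yes refl = contradiction refl y≢b
      ...   | no  _    = refl
      count-positive : ∀ I ρ σ → 1 ≤ countB I σ (b ∷ []) (λ σ′ → eval I (gd ∅ ∧' eqB b b) ρ σ′)
      count-positive I ρ σ = ≤-trans
        (≤-reflexive (cong (λ c → if c then 1 else 0) (sym (=ᶠ-refl (updB I σ b (σ b) b)))))
        (∈⇒≤sum (∈-map⁺ _ (∈-allFin (σ b))))

  translate-conj : Fin k → ∀ {φs : List (Formula k)} → All Translatable φs → Translatable (conj φs)
  translate-conj b []           = translate-⊤ b
  translate-conj b (t ∷ [])     = t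
  translate-conj b (t ∷ t′ ∷ ts) = translate-∧ t (translate-conj b (t′ ∷ ts))

  translate-gd : Fin k → (g : Guard k) → Translatable (gd g)
  translate-gd b g = translate-conj b (All.tabulate translate-atom)
    where
      translate-atom : ∀ {φ} → φ ∈ atoms g → Translatable φ
      translate-atom m with ∈-atoms⁻ g m
      ... | i , j , _ , refl = translate-E j i

  freeR-guarded : ∀ (g : Guard k) ψ → (∀ i → dom g i ≡ freeR ψ i) →
                  ∀ x → freeR (gd g ∧' ψ) x ≡ dom g x
  freeR-guarded g ψ dg x =
    trans (cong₂ _∨_ (freeR-gd g x) (sym (dg x))) (∨-idem (dom g x))

  module _ {g′ : Guard k} (g : Guard k) {ψ : Formula k} (T : Translation g′ (gd g ∧' ψ)) where

    body-agrees : ∀ I ρ σ → (eval I (gd g) ρ σ ≡ true → eval I (gd g′) ρ σ ≡ true) →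
                  eval I (gd g ∧' ψ) ρ σ ≡ eval I (gd g′ ∧' formula T) ρ σ
    body-agrees I ρ σ g⇒g′ = ∧-transfer _ _ _ _ g⇒g′ (agrees T I ρ σ)

    body-freeR : (∀ i → dom g′ i ≡ dom g i) → (∀ i → dom g i ≡ freeR ψ i) →
                 ∀ x → freeR (gd g ∧' ψ) x ≡ freeR (gd g′ ∧' formula T) x
    body-freeR dg′ dg x = begin
      freeR (gd g ∧' ψ) x                      ≡⟨ freeR-guarded g ψ dg x ⟩
      dom g x                                  ≡⟨ sym (∨-idem _) ⟩
      dom g x ∨ dom g x                        ≡⟨ cong₂ _∨_ (sym (trans (freeR-gd g′ x) (dg′ x)))
                                                            (trans (sym (freeR-guarded g ψ dg x))
                                                                   (same-freeR T x)) ⟩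
      freeR (gd g′) x ∨ freeR (formula T) x    ∎
      where open ≡-Reasoning

    body-freeB : ∀ {f : Guard k} → (∀ {i j} → fun g′ i ≡ just j → InIm g j ⊎ InIm f j) →
                 ∀ y → freeB (gd f) y ≡ false → freeB (gd g ∧' ψ) y ≡ freeB (gd g′ ∧' formula T) y
    body-freeB {f} cover y f∌y with freeB (gd g′) y in g′∋y
    ... | false = same-freeB T y g′∋y
    ... | true with freeB-gd⁻ g′ y g′∋y
    ...   | _ , g′i with cover g′i
    ...     | inj₁ (_ , gi) rewrite freeB-gd⁺ g gi = refl
    ...     | inj₂ (_ , fi) with () ← trans (sym (freeB-gd⁺ f fi)) f∌y

  freeB-preserved : ∀ {g : Guard k} {φ} (T : Translation g φ) y →
                    freeB φ y ≡ true → freeB (gd g ∧' formula T) y ≡ true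
  freeB-preserved {g} T y φ∋y with freeB (gd g) y in g∋y
  ... | true  = refl
  ... | false = trans (sym (same-freeB T y g∋y)) φ∋y

  translate-∃R : ∀ {ψ} (g : Guard k) n xs → Translatable (gd g ∧' ψ) →
                 (∀ i → dom g i ≡ freeR ψ i) → 1 ≤ n → 1 ≤ length xs → Linked _<_ xs →
                 All (λ x → freeR (gd g ∧' ψ) x ≡ true) xs →
                 Translatable (∃R n xs (gd g ∧' ψ))
  translate-∃R {ψ} g n xs t dg n≥1 xs≥1 sorted xs-free f df = record
    { formula    = ∃R n xs (gd g′ ∧' formula T)
    ; restricted = rgc-∃R f n xs (restricted T) n≥1 xs≥1 sorted
                     (All.map (λ {x} → trans (trans (dom-g′ x) (sym (freeR-guarded g ψ dg x)))) xs-free)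
                     f≡g′-xs
    ; agrees     = λ I ρ σ f-holds → cong (n ≤ᵇ_) (countR-cong I ρ xs λ ρ′ agree →
                     body-agrees g T I ρ′ σ (g⇒g′ f-holds agree))
    ; same-freeR = λ x → cong (not (elemℕ x xs) ∧_) (body-freeR g T dom-g′ dg x)
    ; same-freeB = body-freeB g T {f} (splice-cover bound-var g f)
    }
    where
      bound-var : ℕ → Bool
      bound-var i = elemℕ i xs
      g′ : Guard k
      g′ = splice bound-var g f
      dom-f : ∀ i → dom f i ≡ not (bound-var i) ∧ dom g i
      dom-f i = trans (df i) (cong (not (bound-var i) ∧_) (freeR-guarded g ψ dg i))
      dom-g′ : ∀ i → dom g′ i ≡ dom g i
      dom-g′ = dom-splice bound-var g f λ i e → trans (dom-f i) (cong (λ c → not c ∧ dom g i) e)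
      T : Translation g′ (gd g ∧' ψ)
      T = t g′ λ i → trans (dom-g′ i) (sym (freeR-guarded g ψ dg i))
      f≡g′-xs : ∀ i → fun f i ≡ minusFun g′ xs i
      f≡g′-xs i with bound-var i in e
      ... | true  = dom-false⇒nothing f (trans (dom-f i) (cong (λ c → not c ∧ dom g i) e))
      ... | false = refl
      g⇒g′ : ∀ {I ρ ρ′ σ} → eval I (gd f) ρ σ ≡ true → (∀ i → bound-var i ≡ false → ρ′ i ≡ ρ i) →
             eval I (gd g) ρ′ σ ≡ true → eval I (gd g′) ρ′ σ ≡ true
      g⇒g′ {I} {ρ′ = ρ′} {σ} f-holds agree g-holds =
        eval-gd⁺ g′ (splice-holds {I = I} {ρ = ρ′} {σ = σ} bound-var g f (eval-gd⁻ g g-holds)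
          λ {i} {j} free fi →
            subst (λ r → E I (σ j) r ≡ true) (sym (agree i free)) (eval-gd⁻ f f-holds fi))

  translate-∃B : ∀ {ψ} (g : Guard k) n ys → Translatable (gd g ∧' ψ) →
                 (∀ i → dom g i ≡ freeR ψ i) → 1 ≤ n → 1 ≤ length ys → Linked _<F_ ys →
                 All (λ y → freeB (gd g ∧' ψ) y ≡ true) ys →
                 Translatable (∃B n ys (gd g ∧' ψ))
  translate-∃B {ψ} g n ys t dg n≥1 ys≥1 sorted ys-free f df = record
    { formula    = ∃B n ys (gd g′ ∧' formula T)
    ; restricted = rgc-∃B f n ys (restricted T) n≥1 ys≥1 sorted
                     (All.map (freeB-preserved T _) ys-free)
                     (λ i → trans (dom-f i) (sym (dom-g′ i)))
                     retargeted
    ; agrees     = λ I ρ σ f-holds → cong (n ≤ᵇ_) (countB-cong I σ ys λ σ′ agree →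
                     body-agrees g T I ρ σ′ (g⇒g′ f-holds agree))
    ; same-freeR = body-freeR g T dom-g′ dg
    ; same-freeB = λ y f∌y →
        cong (not (elemF y ys) ∧_) (body-freeB g T {f} (splice-cover bound-target g f) y f∌y)
    }
    where
      -- g′ follows g where f points to a quantified blue variable and f elsewhere (rule (7)).
      bound-target : ℕ → Bool
      bound-target i = maybe′ (λ j → elemF j ys) true (fun f i)
      g′ : Guard k
      g′ = splice bound-target g f
      dom-f : ∀ i → dom f i ≡ dom g i
      dom-f i = trans (df i) (freeR-guarded g ψ dg i)
      dom-g′ : ∀ i → dom g′ i ≡ dom g i
      dom-g′ = dom-splice bound-target g f λ i _ → dom-f i
      T : Translation g′ (gd g ∧' ψ)
      T = t g′ λ i → trans (dom-g′ i) (sym (freeR-guarded g ψ dg i))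
      retargeted : ∀ i j → fun f i ≡ just j → fun g′ i ≡ just j ⊎ j ∈ ys ⊎ ¬ InIm g′ j
      retargeted i j fi rewrite fi with elemF j ys in e
      ... | true  = inj₂ (inj₁ (elemF⇒∈ ys e))
      ... | false = inj₁ refl
      g⇒g′ : ∀ {I ρ σ σ′} → eval I (gd f) ρ σ ≡ true → (∀ j → elemF j ys ≡ false → σ′ j ≡ σ j) →
             eval I (gd g) ρ σ′ ≡ true → eval I (gd g′) ρ σ′ ≡ true
      g⇒g′ {I} {ρ} {σ′ = σ′} f-holds agree g-holds =
        eval-gd⁺ g′ (splice-holds {I = I} {ρ = ρ} {σ = σ′} bound-target g f (eval-gd⁻ g g-holds)
          λ {i} {j} free fi →
            subst (λ s → E I s (ρ i) ≡ true)
                  (sym (agree j (subst (λ m → maybe′ _ true m ≡ false) fi free)))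
                  (eval-gd⁻ f f-holds fi))

  translate : Fin k → ∀ {φ : Formula k} → GC φ → Translatable φ
  translate b gc-⊤            = translate-⊤ b
  translate b (gc-E j i)      = translate-E j i
  translate b (gc-eqB j j′)   = translate-eqB j j′
  translate b (gc-eqR i i′)   = translate-eqR i i′
  translate b (gc-¬ gφ)       = translate-¬ (translate b gφ)
  translate b (gc-∧ gφ gψ)    = translate-∧ (translate b gφ) (translate b gψ)
  translate b (gc-∃R g n xs gψ dg n≥1 xs≥1 sorted free) =
    translate-∃R g n xs (translate-∧ (translate-gd b g) (translate b gψ)) dg n≥1 xs≥1 sorted free
  translate b (gc-∃B g n ys gψ dg n≥1 ys≥1 sorted free) =
    translate-∃B g n ys (translate-∧ (translate-gd b g) (translate b gψ)) dg n≥1 ys≥1 sorted free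

theorem5 : (k : ℕ) → 1 ≤ k →
    (φ : Formula k) → GC φ →
    (f : Guard k) → (∀ i → dom f i ≡ freeR φ i) →
    Σ (Formula k) λ φf →
      RGC f φf ×
      Equivalent (gd f ∧' φ) (gd f ∧' φf) ×
      SameFree (gd f ∧' φ) (gd f ∧' φf)
theorem5 (suc k) _ φ gφ f df =
  formula T , restricted T ,
  (λ I ρ σ → ∧-guarded-cong (agrees T I ρ σ)) ,
  (λ x → cong (freeR (gd f) x ∨_) (same-freeR T x)) ,
  (λ y → ∨-guarded-cong (same-freeB T y))
  where
    T : Translation f φ
    T = translate F.zero gφ f df
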